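{- For every $n\in\mathbb{N}$, writing $n=\prod_{p}p^{\nu_p(n)}$, \[ H(n):=\varphi(n)\Bigg(\sum_{\substack{a=1\\ (a,n)=1}}^{n}\frac{1}{(a-1,n)}\Bigg)^{ -1}=\prod_{p\ \text{prime}}\left(1-\frac{p}{p^2-1}\left(1-\frac{1}{p^{2\nu_p(n)}}\right)\right)^{ -1}. \]
   Context: $(x,y)$ denotes the greatest common divisor (with $(0,n)=n$), $\varphi$ is Euler's totient function, and $\nu_p(n)$ is the exponent of the prime $p$ in $n$ (zero for all but finitely many $p$). -}

module Defs where

open import Data.Nat as ℕ using (ℕ; zero; suc; _∸_; _^_; _≤?_)
open import Data.Nat.DivMod using (_/_)
open import Data.Nat.Divisibility using (_∣?_)
open import Data.Nat.GCD using (gcd)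
open import Data.Nat.Primality using (prime?)
open import Data.Integer using (+_; -[1+_])
open import Data.Rational using (ℚ; mkℚ; 0ℚ; 1ℚ; 1/_; _+_; _*_; _-_)
import Data.Rational as Q
open import Data.List using (List; []; _∷_; filter; map; foldr; upTo)
open import Relation.Nullary using (yes; no)

range1 : ℕ → List ℕ
range1 n = map suc (upTo n)

φ : ℕ → ℕ
φ n = Data.List.length (filter (λ a → gcd a n ℕ.≟ 1) (range1 n))
  where import Data.List

-- ν p n : exponent of p in n (for p ≥ 2, n ≥ 1), computed by repeated
-- division; fuel n suffices.  Conventionally 0 when p < 2 or n = 0.
νaux : ℕ → ℕ → ℕ → ℕ
νaux p n zero = zero
νaux zero n (suc k) = zero
νaux (suc zero) n (suc k) = zero
νaux (suc (suc q)) zero (suc k) = zero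
νaux (suc (suc q)) (suc m) (suc k) with suc (suc q) ∣? suc m
... | yes _ = suc (νaux (suc (suc q)) (suc m / suc (suc q)) k)
... | no _ = zero

ν : ℕ → ℕ → ℕ
ν p n = νaux p n n

-- Total reciprocal on ℚ (value 0 at 0; only ever applied to nonzero values).
inv : ℚ → ℚ
inv q@(mkℚ (+ zero) _ _) = 0ℚ
inv q@(mkℚ (+ suc _) _ _) = 1/ q
inv q@(mkℚ -[1+ _ ] _ _) = 1/ q

ℕtoℚ : ℕ → ℚ
ℕtoℚ n = + n Q./ 1

sumℚ : List ℚ → ℚ
sumℚ = foldr _+_ 0ℚ

prodℚ : List ℚ → ℚ
prodℚ = foldr _*_ 1ℚ

Ssum : ℕ → ℚ
Ssum n = sumℚ (map (λ a → inv (ℕtoℚ (gcd (a ∸ 1) n)))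
                   (filter (λ a → gcd a n ℕ.≟ 1) (range1 n)))

H : ℕ → ℚ
H n = ℕtoℚ (φ n) * inv (Ssum n)

factor : ℕ → ℕ → ℚ
factor n p = inv (1ℚ - (ℕtoℚ p * inv (ℕtoℚ (p ^ 2) - 1ℚ))
                         * (1ℚ - inv (ℕtoℚ (p ^ (2 ℕ.* ν p n)))))

-- Product over all primes; primes p > n (n ≥ 1) have ν_p(n) = 0 and
-- contribute the factor 1, so it suffices to range over primes p ≤ n.
eulerProduct : ℕ → ℚ
eulerProduct n = prodℚ (map (factor n) (filter prime? (range1 n)))

-- Both sides are multiplicative functions of n that agree at n = 1, so it suffices to compare them
-- at prime powers.  For H, both φ(n) and S(n) = Σ_{(a,n)=1} 1/(a-1,n) are sums over the residues
-- mod n of summands that factor over coprime moduli, and the Chinese remainder theorem makes such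
-- sums multiplicative; for the Euler product, ν_p is additive.  At n = p^(e+1), cutting the residues
-- into blocks of p consecutive ones shows that T_e = Σ_{b<p^e} 1/(b,p^e) satisfies
-- T_(e+1) = T_e/p + p^e(p-1), hence (p+1)T_e = p^(e+1) + p^(-e), and that S(p^(e+1)) = T_e/p + p^e(p-2)
-- and φ(p^(e+1)) = p^e(p-1).  After clearing the denominator p² - 1, the claimed value of H(p^(e+1))
-- becomes a polynomial identity.

module Submission where

open import Defs
open import Data.Nat using (ℕ; _≥_; suc; _^_)
open import Data.Nat.Primality using (Prime)
open import Relation.Binary.PropositionalEquality as ≡ using (_≡_)
import Algebra
import Data.Rational

module RangeFold {c ℓ} (M : Algebra.CommutativeMonoid c ℓ) where
  open Algebra.CommutativeMonoid M renaming (Carrier to A)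
  open import Algebra.Properties.CommutativeSemigroup commutativeSemigroup using (interchange)
  open import Algebra.Properties.CommutativeMonoid.Sum M using (sum; sum-cong-≗; sum-permute)
  open import Data.Nat using (zero; suc; _+_; _*_; _<_; z≤n; s≤s)
  import Data.Nat.Properties as ℕ
  open import Data.Fin as Fin using (Fin; toℕ; fromℕ<)
  import Data.Fin.Properties as Fin
  open import Data.List using ([]; _∷_; foldr; map; filter; applyUpTo; upTo)
  open import Data.List.Properties using (map-∘)
  open import Data.Fin.Permutation using (permutation)
  open import Data.Product using (∃; _,_; proj₁; proj₂)
  open import Function using (_∘_; id)
  open import Relation.Nullary using (Dec; yes; no; contradiction)
  open import Relation.Unary using (Pred; Decidable)
  open import Relation.Binary.PropositionalEquality as ≡ using (_≢_)
  open import Relation.Binary.Reasoning.Setoid setoid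

  fold : ℕ → (ℕ → A) → A
  fold zero f = ε
  fold (suc n) f = f 0 ∙ fold n (f ∘ suc)

  fold-cong : ∀ n {f g : ℕ → A} → (∀ i → i < n → f i ≈ g i) → fold n f ≈ fold n g
  fold-cong zero f≈g = refl
  fold-cong (suc n) f≈g = ∙-cong (f≈g 0 (s≤s z≤n)) (fold-cong n (λ i i<n → f≈g (suc i) (s≤s i<n)))

  fold-ε : ∀ n {f : ℕ → A} → (∀ i → i < n → f i ≈ ε) → fold n f ≈ ε
  fold-ε zero f≈ε = refl
  fold-ε (suc n) f≈ε = trans (∙-cong (f≈ε 0 (s≤s z≤n)) (fold-ε n (λ i i<n → f≈ε (suc i) (s≤s i<n)))) (identityˡ ε)

  fold-∙ : ∀ n (f g : ℕ → A) → fold n (λ i → f i ∙ g i) ≈ fold n f ∙ fold n g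
  fold-∙ zero f g = sym (identityˡ ε)
  fold-∙ (suc n) f g = trans (∙-congˡ (fold-∙ n (f ∘ suc) (g ∘ suc))) (interchange (f 0) (g 0) _ _)

  fold-suc : ∀ n (f : ℕ → A) → fold (suc n) f ≈ fold n f ∙ f n
  fold-suc zero f = trans (identityʳ (f 0)) (sym (identityˡ (f 0)))
  fold-suc (suc n) f = trans (∙-congˡ (fold-suc n (f ∘ suc))) (sym (assoc (f 0) _ _))

  fold-+ : ∀ m n (f : ℕ → A) → fold (m + n) f ≈ fold m f ∙ fold n (λ i → f (m + i))
  fold-+ zero n f = sym (identityˡ _)
  fold-+ (suc m) n f = trans (∙-congˡ (fold-+ m n (f ∘ suc))) (sym (assoc (f 0) _ _))

  fold-* : ∀ k m (f : ℕ → A) → fold (k * m) f ≈ fold k (λ j → fold m (λ b → f (m * j + b)))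
  fold-* zero m f = refl
  fold-* (suc k) m f = begin
    fold (m + k * m) f
      ≈⟨ fold-+ m (k * m) f ⟩
    fold m f ∙ fold (k * m) (λ i → f (m + i))
      ≈⟨ ∙-cong first-block (fold-* k m _) ⟩
    fold m (λ b → f (m * 0 + b)) ∙ fold k (λ j → fold m (λ b → f (m + (m * j + b))))
      ≈⟨ ∙-congˡ (fold-cong k (λ j _ → fold-cong m (λ b _ → reflexive (≡.cong f (shift j b))))) ⟩
    fold m (λ b → f (m * 0 + b)) ∙ fold k (λ j → fold m (λ b → f (m * suc j + b))) ∎
    where
    first-block : fold m f ≈ fold m (λ b → f (m * 0 + b))
    first-block = fold-cong m (λ b _ → reflexive (≡.cong (λ z → f (z + b)) (≡.sym (ℕ.*-zeroʳ m))))
    shift : ∀ j b → m + (m * j + b) ≡ m * suc j + b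
    shift j b = ≡.trans (≡.sym (ℕ.+-assoc m (m * j) b)) (≡.cong (_+ b) (≡.sym (ℕ.*-suc m j)))

  fold-comm : ∀ m n (F : ℕ → ℕ → A) → fold m (λ i → fold n (F i)) ≈ fold n (λ j → fold m (λ i → F i j))
  fold-comm zero n F = sym (fold-ε n (λ _ _ → refl))
  fold-comm (suc m) n F = trans (∙-congˡ (fold-comm m n (F ∘ suc))) (sym (fold-∙ n (F 0) _))

  fold-single : ∀ n j (f : ℕ → A) → j < n → (∀ i → i < n → i ≢ j → f i ≈ ε) → fold n f ≈ f j
  fold-single (suc n) zero f _ others =
    trans (∙-congˡ (fold-ε n (λ i i<n → others (suc i) (s≤s i<n) λ ()))) (identityʳ (f 0))
  fold-single (suc n) (suc j) f (s≤s j<n) others = begin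
    f 0 ∙ fold n (f ∘ suc) ≈⟨ ∙-cong (others 0 (s≤s z≤n) λ ()) (fold-single n j (f ∘ suc) j<n rest) ⟩
    ε ∙ f (suc j)          ≈⟨ identityˡ (f (suc j)) ⟩
    f (suc j)              ∎
    where
    rest : ∀ i → i < n → i ≢ j → f (suc i) ≈ ε
    rest i i<n i≢j = others (suc i) (s≤s i<n) (i≢j ∘ ℕ.suc-injective)

  private
    fold≡sum : ∀ n (f : ℕ → A) → fold n f ≡ sum {n} (f ∘ toℕ)
    fold≡sum zero f = ≡.refl
    fold≡sum (suc n) f = ≡.cong (f 0 ∙_) (fold≡sum n (f ∘ suc))

    injective⇒surjective : ∀ {k} (σ : Fin k → Fin k) → (∀ {i j} → σ i ≡ σ j → i ≡ j) → ∀ c → ∃ λ j → σ j ≡ c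
    injective⇒surjective {suc k} σ inj c with Fin.any? (λ j → σ j Fin.≟ c)
    ... | yes hit = hit
    ... | no miss = contradiction (Fin.injective⇒≤ punched-injective) (ℕ.<-irrefl ≡.refl)
      where
      avoids : ∀ j → c ≢ σ j
      avoids j c≡σj = miss (j , ≡.sym c≡σj)
      punched-injective : ∀ {i j} → Fin.punchOut (avoids i) ≡ Fin.punchOut (avoids j) → i ≡ j
      punched-injective eq = inj (Fin.punchOut-injective (avoids _) (avoids _) eq)

  fold-permute : ∀ k (σ : ℕ → ℕ) → (∀ j → j < k → σ j < k) → (∀ i j → i < k → j < k → σ i ≡ σ j → i ≡ j)
               → (f : ℕ → A) → fold k (f ∘ σ) ≈ fold k f
  fold-permute k σ σ<k σ-injective f = begin
    fold k (f ∘ σ)                 ≡⟨ fold≡sum k (f ∘ σ) ⟩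
    sum {k} (f ∘ σ ∘ toℕ)          ≡⟨ sum-cong-≗ {k} σ-toℕ ⟩
    sum {k} (f ∘ toℕ ∘ σ′)         ≈⟨ sym (sum-permute (f ∘ toℕ) π) ⟩
    sum {k} (f ∘ toℕ)              ≡⟨ ≡.sym (fold≡sum k f) ⟩
    fold k f                       ∎
    where
    σ′ : Fin k → Fin k
    σ′ i = fromℕ< (σ<k (toℕ i) (Fin.toℕ<n i))
    σ-toℕ : ∀ i → f (σ (toℕ i)) ≡ f (toℕ (σ′ i))
    σ-toℕ i = ≡.cong f (≡.sym (Fin.toℕ-fromℕ< _))
    σ′-injective : ∀ {i j} → σ′ i ≡ σ′ j → i ≡ j
    σ′-injective {i} {j} eq = Fin.toℕ-injective (σ-injective (toℕ i) (toℕ j) (Fin.toℕ<n i) (Fin.toℕ<n j)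
      (≡.trans (≡.sym (Fin.toℕ-fromℕ< _)) (≡.trans (≡.cong toℕ eq) (Fin.toℕ-fromℕ< _))))
    σ′⁻¹ : Fin k → Fin k
    σ′⁻¹ c = proj₁ (injective⇒surjective σ′ σ′-injective c)
    π = permutation σ′ σ′⁻¹ (λ c → proj₂ (injective⇒surjective σ′ σ′-injective c))
                            (λ i → σ′-injective (proj₂ (injective⇒surjective σ′ σ′-injective (σ′ i))))

  foldr-map-range1 : ∀ n (h : ℕ → A) → foldr _∙_ ε (map h (range1 n)) ≡ fold n (h ∘ suc)
  foldr-map-range1 n h = ≡.trans (≡.cong (foldr _∙_ ε) (≡.sym (map-∘ (upTo n)))) (foldr-applyUpTo n (h ∘ suc) id)
    where
    foldr-applyUpTo : ∀ n (g : ℕ → A) (f : ℕ → ℕ) → foldr _∙_ ε (map g (applyUpTo f n)) ≡ fold n (g ∘ f)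
    foldr-applyUpTo zero g f = ≡.refl
    foldr-applyUpTo (suc n) g f = ≡.cong (g (f 0) ∙_) (foldr-applyUpTo n g (f ∘ suc))

  select : ∀ {p} {P : Set p} → Dec P → A → A
  select (yes _) x = x
  select (no _) x = ε

  foldr-filter : ∀ {p} {P : Pred ℕ p} (P? : Decidable P) (w : ℕ → A) xs
               → foldr _∙_ ε (map w (filter P? xs)) ≈ foldr _∙_ ε (map (λ a → select (P? a) (w a)) xs)
  foldr-filter P? w [] = refl
  foldr-filter P? w (x ∷ xs) with P? x
  ... | yes _ = ∙-congˡ (foldr-filter P? w xs)
  ... | no _ = trans (foldr-filter P? w xs) (sym (identityˡ _))

module Arithmetic where
  open import Data.Nat
  open import Data.Nat.Properties
  open import Data.Nat.DivMod using (_%_; _/_; m≡m%n+[m/n]*n)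
  open import Data.Nat.Divisibility
  open import Data.Nat.GCD
  open import Data.Nat.Coprimality using (Coprime; coprime-divisor; coprime⇒gcd≡1)
  open import Data.Nat.Primality using (Prime; prime⇒irreducible; prime⇒nonTrivial; prime⇒nonZero)
  open import Data.Nat.Primality.Factorisation using (factorise)
  open import Data.Nat.ListAction using (product)
  open import Data.List using ([]; _∷_)
  open import Data.List.Relation.Unary.All using (_∷_)
  open import Data.Product using (∃; _×_; _,_)
  open import Data.Sum using (inj₁; inj₂)
  open import Relation.Nullary using (¬_; contradiction)
  open import Relation.Binary.PropositionalEquality
  open ≡-Reasoning

  gcd[m+nk,n]≡gcd[m,n] : ∀ m n k → gcd (m + n * k) n ≡ gcd m n
  gcd[m+nk,n]≡gcd[m,n] m n k = ∣-antisym
    (gcd-greatest (∣m+n∣m⇒∣n g∣nk+m (∣m⇒∣m*n k (gcd[m,n]∣n (m + n * k) n))) (gcd[m,n]∣n (m + n * k) n))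
    (gcd-greatest (∣m∣n⇒∣m+n (gcd[m,n]∣m m n) (∣m⇒∣m*n k (gcd[m,n]∣n m n))) (gcd[m,n]∣n m n))
    where
    g∣nk+m : gcd (m + n * k) n ∣ n * k + m
    g∣nk+m = subst (gcd (m + n * k) n ∣_) (+-comm m (n * k)) (gcd[m,n]∣m (m + n * k) n)

  gcd-*-coprime : ∀ x {m k} → Coprime m k → gcd x (m * k) ≡ gcd x m * gcd x k
  gcd-*-coprime x {m} {k} m⊥k = ∣-antisym g∣d₁d₂ d₁d₂∣g
    where
    d₁ = gcd x m
    d₂ = gcd x k
    g = gcd x (m * k)
    d₂⊥d₁ : Coprime d₂ d₁
    d₂⊥d₁ (c∣d₂ , c∣d₁) = m⊥k (∣-trans c∣d₁ (gcd[m,n]∣n x m) , ∣-trans c∣d₂ (gcd[m,n]∣n x k))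
    d₁d₂∣x : d₁ * d₂ ∣ x
    d₁d₂∣x with gcd[m,n]∣m x m
    ... | divides t x≡td₁ = subst (d₁ * d₂ ∣_) (trans (*-comm d₁ t) (sym x≡td₁))
      (*-monoʳ-∣ d₁ (coprime-divisor d₂⊥d₁ (subst (d₂ ∣_) (trans x≡td₁ (*-comm t d₁)) (gcd[m,n]∣m x k))))
    d₁d₂∣g : d₁ * d₂ ∣ g
    d₁d₂∣g = gcd-greatest d₁d₂∣x (*-pres-∣ (gcd[m,n]∣n x m) (gcd[m,n]∣n x k))
    g∣md₂ : g ∣ m * d₂
    g∣md₂ = subst (g ∣_) (sym (c*gcd[m,n]≡gcd[cm,cn] m x k))
      (gcd-greatest (∣n⇒∣m*n m (gcd[m,n]∣m x (m * k))) (gcd[m,n]∣n x (m * k)))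
    d₁d₂≡gcd[xd₂,md₂] : d₁ * d₂ ≡ gcd (x * d₂) (m * d₂)
    d₁d₂≡gcd[xd₂,md₂] = trans (*-comm d₁ d₂) (trans (c*gcd[m,n]≡gcd[cm,cn] d₂ x m) (cong₂ gcd (*-comm d₂ x) (*-comm d₂ m)))
    g∣d₁d₂ : g ∣ d₁ * d₂
    g∣d₁d₂ = subst (g ∣_) (sym d₁d₂≡gcd[xd₂,md₂]) (gcd-greatest (∣m⇒∣m*n d₂ (gcd[m,n]∣m x (m * k))) g∣md₂)

  %-cancel⇒∣ : ∀ x y k .{{_ : NonZero k}} → (x + y) % k ≡ x % k → k ∣ y
  %-cancel⇒∣ x y k eq = ∣m+n∣m⇒∣n (subst (k ∣_) quotients (n∣m*n ((x + y) / k))) (n∣m*n (x / k))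
    where
    quotients : (x + y) / k * k ≡ x / k * k + y
    quotients = sym (+-cancelˡ-≡ (x % k) _ _ (begin
      x % k + (x / k * k + y) ≡⟨ +-assoc (x % k) _ y ⟨
      x % k + x / k * k + y   ≡⟨ cong (_+ y) (m≡m%n+[m/n]*n x k) ⟨
      x + y                   ≡⟨ m≡m%n+[m/n]*n (x + y) k ⟩
      (x + y) % k + (x + y) / k * k ≡⟨ cong (_+ (x + y) / k * k) eq ⟩
      x % k + (x + y) / k * k ∎))

  ∣∧<⇒≡0 : ∀ {k d} → k ∣ d → d < k → d ≡ 0
  ∣∧<⇒≡0 {d = zero} _ _ = refl
  ∣∧<⇒≡0 {d = suc d} k∣d d<k = contradiction k∣d (>⇒∤ d<k)

  offset-%-injective : ∀ b m k .{{_ : NonZero k}} → Coprime k m → ∀ {i j} → i ≤ j → j < k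
                     → (b + m * j) % k ≡ (b + m * i) % k → j ≡ i
  offset-%-injective b m k k⊥m {i} {j} i≤j j<k eq = begin
    j           ≡⟨ m+[n∸m]≡n i≤j ⟨
    i + (j ∸ i) ≡⟨ cong (i +_) (∣∧<⇒≡0 k∣offset (≤-<-trans (m∸n≤m j i) j<k)) ⟩
    i + 0       ≡⟨ +-identityʳ i ⟩
    i           ∎
    where
    split : b + m * i + m * (j ∸ i) ≡ b + m * j
    split = trans (+-assoc b _ _) (cong (b +_) (trans (sym (*-distribˡ-+ m i (j ∸ i))) (cong (m *_) (m+[n∸m]≡n i≤j))))
    k∣offset : k ∣ j ∸ i
    k∣offset = coprime-divisor k⊥m (%-cancel⇒∣ (b + m * i) (m * (j ∸ i)) k (trans (cong (_% k) split) eq))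

  affine-%-injective : ∀ b m k .{{_ : NonZero k}} → Coprime k m → ∀ i j → i < k → j < k
                     → (b + m * i) % k ≡ (b + m * j) % k → i ≡ j
  affine-%-injective b m k k⊥m i j i<k j<k eq with ≤-total i j
  ... | inj₁ i≤j = sym (offset-%-injective b m k k⊥m i≤j j<k (sym eq))
  ... | inj₂ j≤i = offset-%-injective b m k k⊥m j≤i i<k eq

  coprime-^ : ∀ {y n} → Coprime y n → ∀ j → Coprime y (n ^ j)
  coprime-^ y⊥n zero (_ , c∣1) = ∣1⇒≡1 c∣1
  coprime-^ {y} {n} y⊥n (suc j) {c} (c∣y , c∣n*n^j) = coprime-^ y⊥n j (c∣y , coprime-divisor c⊥n c∣n*n^j)
    where
    c⊥n : Coprime c n
    c⊥n (d∣c , d∣n) = y⊥n (∣-trans d∣c c∣y , d∣n)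

  prime∤⇒coprime : ∀ {p y} → Prime p → ¬ p ∣ y → Coprime y p
  prime∤⇒coprime p-prime p∤y {c} (c∣y , c∣p) with prime⇒irreducible p-prime c∣p
  ... | inj₁ c≡1 = c≡1
  ... | inj₂ refl = contradiction c∣y p∤y

  prime⇒>1 : ∀ {p} → Prime p → 1 < p
  prime⇒>1 {p} p-prime = nonTrivial⇒n>1 p {{prime⇒nonTrivial p-prime}}

  prime⇒≢1 : ∀ {p} → Prime p → p ≢ 1
  prime⇒≢1 p-prime = >⇒≢ (prime⇒>1 p-prime)

  prime≤prime^[1+e] : ∀ {p} → Prime p → ∀ e → p ≤ p ^ suc e
  prime≤prime^[1+e] {p} p-prime e = m≤m*n p (p ^ e) {{m^n≢0 p e {{prime⇒nonZero p-prime}}}}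

  prime∤prime^ : ∀ {p q} → Prime p → Prime q → q ≢ p → ∀ j → ¬ q ∣ p ^ j
  prime∤prime^ {p} {q} p-prime q-prime q≢p j q∣p^j =
    prime⇒≢1 q-prime (coprime-^ (prime∤⇒coprime p-prime p∤q) j (∣-refl , q∣p^j))
    where
    p∤q : ¬ p ∣ q
    p∤q p∣q with prime⇒irreducible q-prime p∣q
    ... | inj₁ p≡1 = prime⇒≢1 p-prime p≡1
    ... | inj₂ p≡q = q≢p (sym p≡q)

  gcd[pq+r,p^j]≡1 : ∀ {p} → Prime p → ∀ q {r} → 0 < r → r < p → ∀ j → gcd (p * q + r) (p ^ j) ≡ 1
  gcd[pq+r,p^j]≡1 {p} p-prime q {r} 0<r r<p j = coprime⇒gcd≡1 (coprime-^ (prime∤⇒coprime p-prime p∤pq+r) j)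
    where
    p∤pq+r : ¬ p ∣ p * q + r
    p∤pq+r p∣pq+r = >⇒≢ 0<r (∣∧<⇒≡0 (∣m+n∣m⇒∣n p∣pq+r (m∣m*n q)) r<p)

  gcd[pq,p^1+j]≡p*gcd[q,p^j] : ∀ p q j → gcd (p * q) (p ^ suc j) ≡ p * gcd q (p ^ j)
  gcd[pq,p^1+j]≡p*gcd[q,p^j] p q j = sym (c*gcd[m,n]≡gcd[cm,cn] p q (p ^ j))

  gcd[pq+p,p^1+j]≢1 : ∀ {p} → Prime p → ∀ q j → gcd (p * q + p) (p ^ suc j) ≢ 1
  gcd[pq+p,p^1+j]≢1 {p} p-prime q j gcd≡1 =
    prime⇒≢1 p-prime (∣1⇒≡1 (subst (p ∣_) gcd≡1 (gcd-greatest p∣pq+p (m∣m*n (p ^ j)))))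
    where
    p∣pq+p : p ∣ p * q + p
    p∣pq+p = ∣m∣n⇒∣m+n (m∣m*n q) ∣-refl

  prime-divisor : ∀ n → 2 ≤ n → ∃ λ p → Prime p × p ∣ n
  prime-divisor n@(suc (suc _)) _ with factorise n
  ... | record { factors = [] ; isFactorisation = () }
  ... | record { factors = p ∷ ps ; isFactorisation = n≡p*ps ; factorsPrime = p-prime ∷ _ } =
    p , p-prime , divides (product ps) (trans n≡p*ps (*-comm p (product ps)))
  prime-divisor (suc zero) (s≤s ())

module Valuation where
  open import Data.Nat
  open import Data.Nat.Properties
  open import Data.Nat.DivMod using (_/_; m*n/n≡m; m/n<m)
  open import Data.Nat.Divisibility
  open import Data.Nat.Induction using (<-rec)
  open import Data.Nat.Primality using (Prime; prime⇒nonTrivial; euclidsLemma)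
  open import Data.Product using (∃₂; _×_; _,_)
  open import Data.Sum using (inj₁; inj₂)
  open import Relation.Nullary using (¬_; yes; no; contradiction)
  open import Relation.Binary.PropositionalEquality
  open import Algebra.Properties.CommutativeSemigroup *-commutativeSemigroup using () renaming (interchange to *-interchange)
  open Arithmetic using (prime⇒≢1)
  open import Function using (_∘_)

  PrimePowerSplit : ℕ → ℕ → Set
  PrimePowerSplit p n = ∃₂ λ j m → n ≡ p ^ j * m × ¬ p ∣ m × 1 ≤ m

  prime-power-split : ∀ {p} → Prime p → ∀ n → 1 ≤ n → PrimePowerSplit p n
  prime-power-split {p} p-prime = <-rec (λ n → 1 ≤ n → PrimePowerSplit p n) split
    where
    split : ∀ n → (∀ {t} → t < n → 1 ≤ t → PrimePowerSplit p t) → 1 ≤ n → PrimePowerSplit p n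
    split n rec 1≤n with p ∣? n
    ... | no p∤n = 0 , n , sym (*-identityˡ n) , p∤n , 1≤n
    ... | yes p∣n with rec (quotient-< p∣n {{prime⇒nonTrivial p-prime}} {{>-nonZero 1≤n}})
                           (>-nonZero⁻¹ _ {{quotient≢0 p∣n {{>-nonZero 1≤n}}}})
    ...   | j , m , t≡p^jm , p∤m , 1≤m = suc j , m , n≡p^[1+j]m , p∤m , 1≤m
      where
      n≡p^[1+j]m : n ≡ p ^ suc j * m
      n≡p^[1+j]m = trans (m∣n⇒n≡m*quotient p∣n) (trans (cong (p *_) t≡p^jm) (sym (*-assoc p (p ^ j) m)))

  private
    νaux-exact : ∀ k j m fuel n → n ≡ (2 + k) ^ j * m → ¬ 2 + k ∣ m → 1 ≤ m → n ≤ fuel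
               → νaux (2 + k) n fuel ≡ j
    νaux-exact k j m fuel zero 0≡p^jm p∤m 1≤m _ =
      contradiction (sym 0≡p^jm) (>⇒≢ (*-mono-≤ (m^n>0 (2 + k) j) 1≤m))
    νaux-exact k j m (suc fuel) (suc n) n≡p^jm p∤m 1≤m n≤fuel with 2 + k ∣? suc n
    νaux-exact k zero m (suc fuel) (suc n) n≡m p∤m 1≤m _ | yes p∣n =
      contradiction (subst (2 + k ∣_) (trans n≡m (*-identityˡ m)) p∣n) p∤m
    νaux-exact k zero m (suc fuel) (suc n) _ _ _ _ | no _ = refl
    νaux-exact k (suc j) m (suc fuel) (suc n) n≡p^[1+j]m p∤m 1≤m (s≤s n≤fuel) | yes _ =
      cong suc (νaux-exact k j m fuel (suc n / (2 + k)) quotient≡ p∤m 1≤m quotient≤fuel)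
      where
      quotient≡ : suc n / (2 + k) ≡ (2 + k) ^ j * m
      quotient≡ = trans (cong (_/ (2 + k)) (trans n≡p^[1+j]m (trans (*-assoc (2 + k) ((2 + k) ^ j) m)
                                                                     (*-comm (2 + k) ((2 + k) ^ j * m)))))
                        (m*n/n≡m ((2 + k) ^ j * m) (2 + k))
      quotient≤fuel : suc n / (2 + k) ≤ fuel
      quotient≤fuel = <⇒≤pred (<-≤-trans (m/n<m (suc n) (2 + k) (s≤s (s≤s z≤n))) (s≤s n≤fuel))
    νaux-exact k (suc j) m (suc fuel) (suc n) n≡p^[1+j]m _ _ _ | no p∤n =
      contradiction (subst (2 + k ∣_) (sym (trans n≡p^[1+j]m (*-assoc (2 + k) ((2 + k) ^ j) m))) (m∣m*n ((2 + k) ^ j * m)))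
                    p∤n

  ν[p^j*m]≡j : ∀ {p} → Prime p → ∀ j {m} → ¬ p ∣ m → 1 ≤ m → ν p (p ^ j * m) ≡ j
  ν[p^j*m]≡j {suc (suc k)} _ j {m} p∤m 1≤m = νaux-exact k j m _ _ refl p∤m 1≤m ≤-refl

  ν[p^j]≡j : ∀ {p} → Prime p → ∀ j → ν p (p ^ j) ≡ j
  ν[p^j]≡j {p} p-prime j =
    subst (λ n → ν p n ≡ j) (*-identityʳ (p ^ j)) (ν[p^j*m]≡j p-prime j (prime⇒≢1 p-prime ∘ ∣1⇒≡1) ≤-refl)

  ν≡0 : ∀ {p n} → Prime p → ¬ p ∣ n → 1 ≤ n → ν p n ≡ 0
  ν≡0 {p} {n} p-prime p∤n 1≤n = subst (λ m → ν p m ≡ 0) (*-identityˡ n) (ν[p^j*m]≡j p-prime 0 p∤n 1≤n)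

  ν-* : ∀ {p} → Prime p → ∀ {m k} → 1 ≤ m → 1 ≤ k → ν p (m * k) ≡ ν p m + ν p k
  ν-* {p} p-prime {m} {k} 1≤m 1≤k with prime-power-split p-prime m 1≤m | prime-power-split p-prime k 1≤k
  ... | a , m′ , refl , p∤m′ , 1≤m′ | b , k′ , refl , p∤k′ , 1≤k′ = begin
    ν p (p ^ a * m′ * (p ^ b * k′))
      ≡⟨ cong (ν p) regroup ⟩
    ν p (p ^ (a + b) * (m′ * k′))
      ≡⟨ ν[p^j*m]≡j p-prime (a + b) p∤m′k′ (*-mono-≤ 1≤m′ 1≤k′) ⟩
    a + b
      ≡⟨ cong₂ _+_ (ν[p^j*m]≡j p-prime a p∤m′ 1≤m′) (ν[p^j*m]≡j p-prime b p∤k′ 1≤k′) ⟨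
    ν p (p ^ a * m′) + ν p (p ^ b * k′) ∎
    where
    open ≡-Reasoning
    p∤m′k′ : ¬ p ∣ m′ * k′
    p∤m′k′ p∣m′k′ with euclidsLemma m′ k′ p-prime p∣m′k′
    ... | inj₁ p∣m′ = p∤m′ p∣m′
    ... | inj₂ p∣k′ = p∤k′ p∣k′
    regroup : p ^ a * m′ * (p ^ b * k′) ≡ p ^ (a + b) * (m′ * k′)
    regroup = trans (*-interchange (p ^ a) m′ (p ^ b) k′) (cong (_* (m′ * k′)) (sym (^-distribˡ-+-* p a b)))

module Rationals where
  open import Data.Nat as ℕ using (zero; suc)
  import Data.Nat.Properties as ℕ
  open import Data.Integer as ℤ using (+_)
  import Data.Integer.Properties as ℤ
  open import Data.Maybe using (Maybe; just; nothing)
  open import Data.Rational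
  open import Data.Rational.Properties
  import Data.Rational.Unnormalised as ℚᵘ
  import Data.Rational.Unnormalised.Properties as ℚᵘ
  import Data.Nat.Coprimality as Coprimality
  open import Level using (0ℓ)
  open import Relation.Nullary using (yes; no; contradiction)
  open import Relation.Binary.PropositionalEquality
  open import Tactic.RingSolver using (solve-∀)
  open import Tactic.RingSolver.Core.AlmostCommutativeRing using (AlmostCommutativeRing; fromCommutativeRing)

  ring : AlmostCommutativeRing 0ℓ 0ℓ
  ring = fromCommutativeRing +-*-commutativeRing isZero
    where
    isZero : ∀ x → Maybe (0ℚ ≡ x)
    isZero x with 0ℚ ≟ x
    ... | yes 0≡x = just 0≡x
    ... | no _ = nothing

  *-interchange : ∀ a b c d → a * b * (c * d) ≡ a * c * (b * d)
  *-interchange = solve-∀ ring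

  private
    ℕtoℚ≡mkℚ : ∀ n → ℕtoℚ n ≡ mkℚ (+ n) 0 (Coprimality.sym (Coprimality.1-coprimeTo n))
    ℕtoℚ≡mkℚ n = normalize-coprime _

    toℚᵘ-ℕtoℚ : ∀ n → toℚᵘ (ℕtoℚ n) ≡ ℚᵘ.mkℚᵘ (+ n) 0
    toℚᵘ-ℕtoℚ n = cong toℚᵘ (ℕtoℚ≡mkℚ n)

  ℕtoℚ-+ : ∀ m n → ℕtoℚ (m ℕ.+ n) ≡ ℕtoℚ m + ℕtoℚ n
  ℕtoℚ-+ m n = toℚᵘ-injective (begin
    toℚᵘ (ℕtoℚ (m ℕ.+ n))
      ≡⟨ toℚᵘ-ℕtoℚ (m ℕ.+ n) ⟩
    ℚᵘ.mkℚᵘ (+ (m ℕ.+ n)) 0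
      ≈⟨ ℚᵘ.*≡* (cong (ℤ._* + 1) (trans (ℤ.pos-+ m n) (sym (cong₂ ℤ._+_ (ℤ.*-identityʳ (+ m))
                                                                     (ℤ.*-identityʳ (+ n)))))) ⟩
    ℚᵘ.mkℚᵘ (+ m) 0 ℚᵘ.+ ℚᵘ.mkℚᵘ (+ n) 0
      ≡⟨ cong₂ ℚᵘ._+_ (toℚᵘ-ℕtoℚ m) (toℚᵘ-ℕtoℚ n) ⟨
    toℚᵘ (ℕtoℚ m) ℚᵘ.+ toℚᵘ (ℕtoℚ n)
      ≈⟨ toℚᵘ-homo-+ (ℕtoℚ m) (ℕtoℚ n) ⟨
    toℚᵘ (ℕtoℚ m + ℕtoℚ n) ∎)
    where open ℚᵘ.≃-Reasoning

  ℕtoℚ-* : ∀ m n → ℕtoℚ (m ℕ.* n) ≡ ℕtoℚ m * ℕtoℚ n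
  ℕtoℚ-* m n = toℚᵘ-injective (begin
    toℚᵘ (ℕtoℚ (m ℕ.* n))                    ≡⟨ toℚᵘ-ℕtoℚ (m ℕ.* n) ⟩
    ℚᵘ.mkℚᵘ (+ (m ℕ.* n)) 0                  ≈⟨ ℚᵘ.*≡* (cong (ℤ._* + 1) (ℤ.pos-* m n)) ⟩
    ℚᵘ.mkℚᵘ (+ m) 0 ℚᵘ.* ℚᵘ.mkℚᵘ (+ n) 0    ≡⟨ cong₂ ℚᵘ._*_ (toℚᵘ-ℕtoℚ m) (toℚᵘ-ℕtoℚ n) ⟨
    toℚᵘ (ℕtoℚ m) ℚᵘ.* toℚᵘ (ℕtoℚ n)        ≈⟨ toℚᵘ-homo-* (ℕtoℚ m) (ℕtoℚ n) ⟨
    toℚᵘ (ℕtoℚ m * ℕtoℚ n)                  ∎)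
    where open ℚᵘ.≃-Reasoning

  ℕtoℚ-≢0 : ∀ {n} → n ≢ 0 → ℕtoℚ n ≢ 0ℚ
  ℕtoℚ-≢0 {n} n≢0 eq = n≢0 (ℤ.+-injective (cong ↥_ (trans (sym (ℕtoℚ≡mkℚ n)) eq)))

  *-inv : ∀ x → x ≢ 0ℚ → x * inv x ≡ 1ℚ
  *-inv (mkℚ (+ zero) zero _) x≢0 = contradiction refl x≢0
  *-inv (mkℚ (+ zero) (suc d) 0⊥d) _ =
    contradiction (Coprimality.0-coprimeTo-m⇒m≡1 (Coprimality.recompute 0⊥d)) λ ()
  *-inv x@(mkℚ (+ suc _) _ _) _ = *-inverseʳ x
  *-inv x@(mkℚ ℤ.-[1+ _ ] _ _) _ = *-inverseʳ x

  ℕtoℚ-∸ : ∀ {m n} → n ℕ.≤ m → ℕtoℚ (m ℕ.∸ n) ≡ ℕtoℚ m - ℕtoℚ n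
  ℕtoℚ-∸ {m} {n} n≤m = begin
    ℕtoℚ (m ℕ.∸ n)                         ≡⟨ a≡a+b-b (ℕtoℚ (m ℕ.∸ n)) (ℕtoℚ n) ⟩
    ℕtoℚ (m ℕ.∸ n) + ℕtoℚ n - ℕtoℚ n       ≡⟨ cong (_- ℕtoℚ n) (ℕtoℚ-+ (m ℕ.∸ n) n) ⟨
    ℕtoℚ (m ℕ.∸ n ℕ.+ n) - ℕtoℚ n          ≡⟨ cong (λ x → ℕtoℚ x - ℕtoℚ n) (ℕ.m∸n+n≡m n≤m) ⟩
    ℕtoℚ m - ℕtoℚ n                        ∎
    where
    open ≡-Reasoning
    a≡a+b-b : ∀ a b → a ≡ a + b - b
    a≡a+b-b = solve-∀ ring

  *-cancelʳ-invertible : ∀ {a b c d} → c * d ≡ 1ℚ → a * c ≡ b * c → a ≡ b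
  *-cancelʳ-invertible {a} {b} {c} {d} cd≡1 ac≡bc = begin
    a             ≡⟨ *-identityʳ a ⟨
    a * 1ℚ        ≡⟨ cong (a *_) cd≡1 ⟨
    a * (c * d)   ≡⟨ *-assoc a c d ⟨
    a * c * d     ≡⟨ cong (_* d) ac≡bc ⟩
    b * c * d     ≡⟨ *-assoc b c d ⟩
    b * (c * d)   ≡⟨ cong (b *_) cd≡1 ⟩
    b * 1ℚ        ≡⟨ *-identityʳ b ⟩
    b             ∎
    where open ≡-Reasoning

  inv-unique : ∀ x y → x * y ≡ 1ℚ → inv x ≡ y
  inv-unique x y xy≡1 with x ≟ 0ℚ
  ... | yes refl = contradiction (trans (sym xy≡1) (*-zeroˡ y)) λ ()
  ... | no x≢0 =
    *-cancelʳ-invertible xy≡1 (trans (trans (*-comm (inv x) x) (*-inv x x≢0)) (trans (sym xy≡1) (*-comm x y)))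

  inv-* : ∀ x y → inv (x * y) ≡ inv x * inv y
  inv-* x y with x ≟ 0ℚ | y ≟ 0ℚ
  ... | yes refl | _ = trans (cong inv (*-zeroˡ y)) (sym (*-zeroˡ (inv y)))
  ... | no _ | yes refl = trans (cong inv (*-zeroʳ x)) (sym (*-zeroʳ (inv x)))
  ... | no x≢0 | no y≢0 = inv-unique (x * y) (inv x * inv y) (begin
    x * y * (inv x * inv y)        ≡⟨ *-interchange x y (inv x) (inv y) ⟩
    x * inv x * (y * inv y)        ≡⟨ cong₂ _*_ (*-inv x x≢0) (*-inv y y≢0) ⟩
    1ℚ * 1ℚ                        ≡⟨⟩
    1ℚ                             ∎)
    where open ≡-Reasoning

  *-inv-* : ∀ x y → x ≢ 0ℚ → x * inv (x * y) ≡ inv y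
  *-inv-* x y x≢0 = begin
    x * inv (x * y)         ≡⟨ cong (x *_) (inv-* x y) ⟩
    x * (inv x * inv y)     ≡⟨ *-assoc x (inv x) (inv y) ⟨
    x * inv x * inv y       ≡⟨ cong (_* inv y) (*-inv x x≢0) ⟩
    1ℚ * inv y              ≡⟨ *-identityˡ (inv y) ⟩
    inv y                   ∎
    where open ≡-Reasoning

module ResidueSums where
  open import Data.Nat as ℕ using (zero; suc; NonZero)
  import Data.Nat.Properties as ℕ
  open import Data.Nat.DivMod using (_%_; _/_; m%n<n; m≡m%n+[m/n]*n)
  open import Data.Nat.GCD using (gcd; gcd-zeroˡ)
  open import Data.Nat.Coprimality as Coprimality using (Coprime)
  open import Data.Rational using (ℚ; 0ℚ; 1ℚ; _+_; _*_)
  open import Data.Rational.Properties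
    using (+-0-commutativeMonoid; *-identityˡ; *-zeroˡ; *-zeroʳ; *-comm; *-distribˡ-+; *-distribʳ-+)
  open import Data.List using (List; []; _∷_; map; length; filter; applyUpTo)
  open import Data.List.Properties using (filter-accept)
  open import Data.Product using (_,_)
  open import Function using (_∘_)
  open import Relation.Nullary using (yes; no; contradiction)
  open import Relation.Binary.PropositionalEquality
  open Rationals
  open Arithmetic using (gcd[m+nk,n]≡gcd[m,n]; gcd-*-coprime; affine-%-injective)

  module Σ = RangeFold +-0-commutativeMonoid

  Σ-const : ∀ n c → Σ.fold n (λ _ → c) ≡ ℕtoℚ n * c
  Σ-const zero c = sym (*-zeroˡ c)
  Σ-const (suc n) c = begin
    c + Σ.fold n (λ _ → c)     ≡⟨ cong₂ _+_ (sym (*-identityˡ c)) (Σ-const n c) ⟩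
    1ℚ * c + ℕtoℚ n * c        ≡⟨ *-distribʳ-+ c 1ℚ (ℕtoℚ n) ⟨
    (1ℚ + ℕtoℚ n) * c          ≡⟨ cong (_* c) (ℕtoℚ-+ 1 n) ⟨
    ℕtoℚ (suc n) * c           ∎
    where open ≡-Reasoning

  Σ-*ˡ : ∀ n c (f : ℕ → ℚ) → c * Σ.fold n f ≡ Σ.fold n (λ i → c * f i)
  Σ-*ˡ zero c f = *-zeroʳ c
  Σ-*ˡ (suc n) c f = trans (*-distribˡ-+ c (f 0) _) (cong (c * f 0 +_) (Σ-*ˡ n c (f ∘ suc)))

  ℕtoℚ-length : ∀ (xs : List ℕ) → ℕtoℚ (length xs) ≡ sumℚ (map (λ _ → 1ℚ) xs)
  ℕtoℚ-length [] = refl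
  ℕtoℚ-length (x ∷ xs) = trans (ℕtoℚ-+ 1 (length xs)) (cong (1ℚ +_) (ℕtoℚ-length xs))

  Periodic : ℕ → (ℕ → ℚ) → Set
  Periodic n f = ∀ x j → f (x ℕ.+ n ℕ.* j) ≡ f x

  periodic⇒% : ∀ {k} .{{_ : NonZero k}} {g : ℕ → ℚ} → Periodic k g → ∀ x → g x ≡ g (x % k)
  periodic⇒% {k} {g = g} g-periodic x = trans (cong g x≡) (g-periodic (x % k) (x / k))
    where
    x≡ : x ≡ x % k ℕ.+ k ℕ.* (x / k)
    x≡ = trans (m≡m%n+[m/n]*n x k) (cong (x % k ℕ.+_) (ℕ.*-comm (x / k) k))

  -- The Chinese remainder theorem: for each b < m, j ↦ (b + m j) mod k permutes the residues mod k.
  Σ-*-periodic : ∀ m k .{{_ : NonZero k}} → Coprime k m → (f g : ℕ → ℚ) → Periodic m f → Periodic k g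
               → Σ.fold (m ℕ.* k) (λ a → f a * g a) ≡ Σ.fold m f * Σ.fold k g
  Σ-*-periodic m k k⊥m f g f-periodic g-periodic = begin
    Σ.fold (m ℕ.* k) h                                       ≡⟨ cong (λ n → Σ.fold n h) (ℕ.*-comm m k) ⟩
    Σ.fold (k ℕ.* m) h                                       ≡⟨ Σ.fold-* k m h ⟩
    Σ.fold k (λ j → Σ.fold m (λ b → h (m ℕ.* j ℕ.+ b)))      ≡⟨ Σ.fold-comm k m _ ⟩
    Σ.fold m (λ b → Σ.fold k (λ j → h (m ℕ.* j ℕ.+ b)))      ≡⟨ Σ.fold-cong m (λ b _ → column b) ⟩
    Σ.fold m (λ b → Σ.fold k g * f b)                        ≡⟨ Σ-*ˡ m (Σ.fold k g) f ⟨
    Σ.fold k g * Σ.fold m f                                  ≡⟨ *-comm (Σ.fold k g) (Σ.fold m f) ⟩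
    Σ.fold m f * Σ.fold k g                                  ∎
    where
    open ≡-Reasoning
    h = λ a → f a * g a
    column : ∀ b → Σ.fold k (λ j → h (m ℕ.* j ℕ.+ b)) ≡ Σ.fold k g * f b
    column b = begin
      Σ.fold k (λ j → h (m ℕ.* j ℕ.+ b))
        ≡⟨ Σ.fold-cong k (λ j _ → reduce j) ⟩
      Σ.fold k (λ j → f b * g ((b ℕ.+ m ℕ.* j) % k))
        ≡⟨ Σ-*ˡ k (f b) _ ⟨
      f b * Σ.fold k (g ∘ (λ j → (b ℕ.+ m ℕ.* j) % k))
        ≡⟨ cong (f b *_) (Σ.fold-permute k _ (λ _ _ → m%n<n _ k) (affine-%-injective b m k k⊥m) g) ⟩
      f b * Σ.fold k g
        ≡⟨ *-comm (f b) _ ⟩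
      Σ.fold k g * f b ∎
      where
      reduce : ∀ j → h (m ℕ.* j ℕ.+ b) ≡ f b * g ((b ℕ.+ m ℕ.* j) % k)
      reduce j rewrite ℕ.+-comm (m ℕ.* j) b = cong₂ _*_ (f-periodic b j) (periodic⇒% g-periodic _)

  Σ-multiplicative : (w : ℕ → ℕ → ℚ) → (∀ n → Periodic n (w n))
                   → (∀ {m k} → Coprime m k → ∀ b → w (m ℕ.* k) b ≡ w m b * w k b)
                   → ∀ {m k} → 1 ℕ.≤ k → Coprime m k
                   → Σ.fold (m ℕ.* k) (w (m ℕ.* k)) ≡ Σ.fold m (w m) * Σ.fold k (w k)
  Σ-multiplicative w w-periodic w-* {m} {k} 1≤k m⊥k =
    trans (Σ.fold-cong (m ℕ.* k) (λ b _ → w-* m⊥k b))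
          (Σ-*-periodic m k {{ℕ.>-nonZero 1≤k}} (Coprimality.sym m⊥k) (w m) (w k) (w-periodic m) (w-periodic k))

  ifCoprime : ℕ → ℕ → ℚ → ℚ
  ifCoprime n a v = Σ.select (gcd a n ℕ.≟ 1) v

  ifCoprime-* : ∀ {m k} → Coprime m k → ∀ a x y → ifCoprime (m ℕ.* k) a (x * y) ≡ ifCoprime m a x * ifCoprime k a y
  ifCoprime-* {m} {k} m⊥k a x y with gcd a (m ℕ.* k) ℕ.≟ 1 | gcd a m ℕ.≟ 1 | gcd a k ℕ.≟ 1
  ... | yes _ | yes _ | yes _ = refl
  ... | yes g≡1 | no gₘ≢1 | _ = contradiction (ℕ.m*n≡1⇒m≡1 (gcd a m) (gcd a k) (gₘgₖ≡1 g≡1)) gₘ≢1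
    where gₘgₖ≡1 = trans (sym (gcd-*-coprime a m⊥k))
  ... | yes g≡1 | yes _ | no gₖ≢1 = contradiction (ℕ.m*n≡1⇒n≡1 (gcd a m) (gcd a k) (gₘgₖ≡1 g≡1)) gₖ≢1
    where gₘgₖ≡1 = trans (sym (gcd-*-coprime a m⊥k))
  ... | no g≢1 | yes gₘ≡1 | yes gₖ≡1 = contradiction (trans (gcd-*-coprime a m⊥k) (cong₂ ℕ._*_ gₘ≡1 gₖ≡1)) g≢1
  ... | no _ | no _ | dₖ = sym (*-zeroˡ (Σ.select dₖ y))
  ... | no _ | yes _ | no _ = sym (*-zeroʳ x)

  ifCoprime-yes : ∀ {n a} v → gcd a n ≡ 1 → ifCoprime n a v ≡ v
  ifCoprime-yes {n} {a} v g≡1 with gcd a n ℕ.≟ 1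
  ... | yes _ = refl
  ... | no g≢1 = contradiction g≡1 g≢1

  ifCoprime-no : ∀ {n a} v → gcd a n ≢ 1 → ifCoprime n a v ≡ 0ℚ
  ifCoprime-no {n} {a} v g≢1 with gcd a n ℕ.≟ 1
  ... | yes g≡1 = contradiction g≡1 g≢1
  ... | no _ = refl

  φ-summand : ℕ → ℕ → ℚ
  φ-summand n b = ifCoprime n (suc b) 1ℚ

  -- The residue a = b + 1 runs over 1, …, n, so (a - 1, n) = gcd b n.
  S-summand : ℕ → ℕ → ℚ
  S-summand n b = ifCoprime n (suc b) (inv (ℕtoℚ (gcd b n)))

  φ≡Σ : ∀ n → ℕtoℚ (φ n) ≡ Σ.fold n (φ-summand n)
  φ≡Σ n = trans (ℕtoℚ-length (filter coprime? (range1 n)))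
                (trans (Σ.foldr-filter coprime? (λ _ → 1ℚ) (range1 n)) (Σ.foldr-map-range1 n _))
    where coprime? = λ a → gcd a n ℕ.≟ 1

  Ssum≡Σ : ∀ n → Ssum n ≡ Σ.fold n (S-summand n)
  Ssum≡Σ n = trans (Σ.foldr-filter (λ a → gcd a n ℕ.≟ 1) _ (range1 n)) (Σ.foldr-map-range1 n _)

  φ≢0 : ∀ {n} → 1 ℕ.≤ n → φ n ≢ 0
  φ≢0 {suc m} _ φ≡0 = contradiction (trans (cong length (sym one-is-coprime)) φ≡0) λ ()
    where
    one-is-coprime = filter-accept (λ a → gcd a (suc m) ℕ.≟ 1) {x = 1} {xs = map suc (applyUpTo suc m)}
                                   (gcd-zeroˡ (suc m))

  reciprocalGcdSum : ℕ → ℚ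
  reciprocalGcdSum n = Σ.fold n (λ b → inv (ℕtoℚ (gcd b n)))

  φ-summand-periodic : ∀ n → Periodic n (φ-summand n)
  φ-summand-periodic n x j = cong (λ g → Σ.select (g ℕ.≟ 1) 1ℚ) (gcd[m+nk,n]≡gcd[m,n] (suc x) n j)

  S-summand-periodic : ∀ n → Periodic n (S-summand n)
  S-summand-periodic n x j = cong₂ (λ g g′ → Σ.select (g ℕ.≟ 1) (inv (ℕtoℚ g′)))
                                   (gcd[m+nk,n]≡gcd[m,n] (suc x) n j) (gcd[m+nk,n]≡gcd[m,n] x n j)

  S-summand-* : ∀ {m k} → Coprime m k → ∀ b → S-summand (m ℕ.* k) b ≡ S-summand m b * S-summand k b
  S-summand-* {m} {k} m⊥k b = trans (cong (ifCoprime (m ℕ.* k) (suc b)) inv-gcd-*) (ifCoprime-* m⊥k (suc b) _ _)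
    where
    inv-gcd-* : inv (ℕtoℚ (gcd b (m ℕ.* k))) ≡ inv (ℕtoℚ (gcd b m)) * inv (ℕtoℚ (gcd b k))
    inv-gcd-* = trans (cong (inv ∘ ℕtoℚ) (gcd-*-coprime b m⊥k))
                      (trans (cong inv (ℕtoℚ-* (gcd b m) (gcd b k))) (inv-* (ℕtoℚ (gcd b m)) (ℕtoℚ (gcd b k))))

  φ-multiplicative : ∀ {m k} → 1 ℕ.≤ k → Coprime m k → ℕtoℚ (φ (m ℕ.* k)) ≡ ℕtoℚ (φ m) * ℕtoℚ (φ k)
  φ-multiplicative {m} {k} 1≤k m⊥k = begin
    ℕtoℚ (φ (m ℕ.* k))
      ≡⟨ φ≡Σ (m ℕ.* k) ⟩
    Σ.fold (m ℕ.* k) (φ-summand (m ℕ.* k))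
      ≡⟨ Σ-multiplicative φ-summand φ-summand-periodic (λ m⊥k b → ifCoprime-* m⊥k (suc b) 1ℚ 1ℚ) 1≤k m⊥k ⟩
    Σ.fold m (φ-summand m) * Σ.fold k (φ-summand k)
      ≡⟨ cong₂ _*_ (φ≡Σ m) (φ≡Σ k) ⟨
    ℕtoℚ (φ m) * ℕtoℚ (φ k) ∎
    where open ≡-Reasoning

  Ssum-multiplicative : ∀ {m k} → 1 ℕ.≤ k → Coprime m k → Ssum (m ℕ.* k) ≡ Ssum m * Ssum k
  Ssum-multiplicative {m} {k} 1≤k m⊥k = begin
    Ssum (m ℕ.* k)
      ≡⟨ Ssum≡Σ (m ℕ.* k) ⟩
    Σ.fold (m ℕ.* k) (S-summand (m ℕ.* k))
      ≡⟨ Σ-multiplicative S-summand S-summand-periodic S-summand-* 1≤k m⊥k ⟩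
    Σ.fold m (S-summand m) * Σ.fold k (S-summand k)
      ≡⟨ cong₂ _*_ (Ssum≡Σ m) (Ssum≡Σ k) ⟨
    Ssum m * Ssum k ∎
    where open ≡-Reasoning

  H-multiplicative : ∀ {m k} → 1 ℕ.≤ k → Coprime m k → H (m ℕ.* k) ≡ H m * H k
  H-multiplicative {m} {k} 1≤k m⊥k = begin
    ℕtoℚ (φ (m ℕ.* k)) * inv (Ssum (m ℕ.* k))
      ≡⟨ cong₂ _*_ (φ-multiplicative 1≤k m⊥k)
                   (trans (cong inv (Ssum-multiplicative 1≤k m⊥k)) (inv-* (Ssum m) (Ssum k))) ⟩
    ℕtoℚ (φ m) * ℕtoℚ (φ k) * (inv (Ssum m) * inv (Ssum k))
      ≡⟨ *-interchange (ℕtoℚ (φ m)) (ℕtoℚ (φ k)) (inv (Ssum m)) (inv (Ssum k)) ⟩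
    H m * H k ∎
    where open ≡-Reasoning

module PrimePowerIdentities where
  open import Data.List using (_∷_; [])
  open import Data.Rational using (1ℚ; _+_; _*_; _-_)
  open import Relation.Binary.PropositionalEquality
  open import Tactic.RingSolver using (solve; solve-∀)
  open Rationals using (ring; *-cancelʳ-invertible)
  open ≡-Reasoning

  closed-form-step : ∀ P i N M T → P * i ≡ 1ℚ → (P + 1ℚ) * T ≡ P * N + M
                   → (P + 1ℚ) * (i * T + N * (P - 1ℚ)) ≡ P * (P * N) + i * M
  closed-form-step P i N M T Pi≡1 closed = begin
    (P + 1ℚ) * (i * T + N * (P - 1ℚ))     ≡⟨ solve (P ∷ i ∷ N ∷ T ∷ []) ring ⟩
    i * ((P + 1ℚ) * T) + N * (P * P - 1ℚ) ≡⟨ cong (λ x → i * x + N * (P * P - 1ℚ)) closed ⟩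
    i * (P * N + M) + N * (P * P - 1ℚ)    ≡⟨ solve (P ∷ i ∷ N ∷ M ∷ []) ring ⟩
    P * i * N + i * M + N * (P * P - 1ℚ)  ≡⟨ cong (λ x → x * N + i * M + N * (P * P - 1ℚ)) Pi≡1 ⟩
    1ℚ * N + i * M + N * (P * P - 1ℚ)     ≡⟨ solve (P ∷ i ∷ N ∷ M ∷ []) ring ⟩
    P * (P * N) + i * M                   ∎

  N+N[P-2]≡N[P-1] : ∀ N P → N * 1ℚ + N * (P - 1ℚ - 1ℚ) ≡ N * (P - 1ℚ)
  N+N[P-2]≡N[P-1] = solve-∀ ring

  prime-power-identity : ∀ P i N M T q → P * i ≡ 1ℚ → N * M ≡ 1ℚ → (P * P - 1ℚ) * q ≡ 1ℚ
                       → (P + 1ℚ) * T ≡ P * N + M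
                       → i * T + N * (P - 1ℚ - 1ℚ) ≡ N * (P - 1ℚ) * (1ℚ - P * q * (1ℚ - i * M * (i * M)))
  prime-power-identity P i N M T q Pi≡1 NM≡1 Qq≡1 closed = *-cancelʳ-invertible Qq≡1 (trans lhs (sym rhs))
    where
    lhs : (i * T + N * (P - 1ℚ - 1ℚ)) * (P * P - 1ℚ) ≡ N * (P - 1ℚ) * (P * P - 1ℚ - P) + (P - 1ℚ) * (i * M)
    lhs = begin
      (i * T + N * (P - 1ℚ - 1ℚ)) * (P * P - 1ℚ)
        ≡⟨ solve (P ∷ i ∷ N ∷ T ∷ []) ring ⟩
      (P - 1ℚ) * (i * ((P + 1ℚ) * T)) + N * (P - 1ℚ - 1ℚ) * (P * P - 1ℚ)
        ≡⟨ cong (λ x → (P - 1ℚ) * (i * x) + N * (P - 1ℚ - 1ℚ) * (P * P - 1ℚ)) closed ⟩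
      (P - 1ℚ) * (i * (P * N + M)) + N * (P - 1ℚ - 1ℚ) * (P * P - 1ℚ)
        ≡⟨ solve (P ∷ i ∷ N ∷ M ∷ []) ring ⟩
      (P - 1ℚ) * (P * i * N) + (P - 1ℚ) * (i * M) + N * (P - 1ℚ - 1ℚ) * (P * P - 1ℚ)
        ≡⟨ cong (λ x → (P - 1ℚ) * (x * N) + (P - 1ℚ) * (i * M) + N * (P - 1ℚ - 1ℚ) * (P * P - 1ℚ)) Pi≡1 ⟩
      (P - 1ℚ) * (1ℚ * N) + (P - 1ℚ) * (i * M) + N * (P - 1ℚ - 1ℚ) * (P * P - 1ℚ)
        ≡⟨ solve (P ∷ i ∷ N ∷ M ∷ []) ring ⟩
      N * (P - 1ℚ) * (P * P - 1ℚ - P) + (P - 1ℚ) * (i * M) ∎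
    rhs : N * (P - 1ℚ) * (1ℚ - P * q * (1ℚ - i * M * (i * M))) * (P * P - 1ℚ)
        ≡ N * (P - 1ℚ) * (P * P - 1ℚ - P) + (P - 1ℚ) * (i * M)
    rhs = begin
      N * (P - 1ℚ) * (1ℚ - P * q * (1ℚ - i * M * (i * M))) * (P * P - 1ℚ)
        ≡⟨ solve (P ∷ i ∷ N ∷ M ∷ q ∷ []) ring ⟩
      N * (P - 1ℚ) * (P * P - 1ℚ - P * ((P * P - 1ℚ) * q))
        + (P - 1ℚ) * (i * M) * (P * i * (N * M) * ((P * P - 1ℚ) * q))
        ≡⟨ cong₂ (λ x y → N * (P - 1ℚ) * (P * P - 1ℚ - P * x) + (P - 1ℚ) * (i * M) * y) Qq≡1
                 (cong₂ _*_ (cong₂ _*_ Pi≡1 NM≡1) Qq≡1) ⟩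
      N * (P - 1ℚ) * (P * P - 1ℚ - P * 1ℚ) + (P - 1ℚ) * (i * M) * (1ℚ * 1ℚ * 1ℚ)
        ≡⟨ solve (P ∷ i ∷ N ∷ M ∷ []) ring ⟩
      N * (P - 1ℚ) * (P * P - 1ℚ - P) + (P - 1ℚ) * (i * M) ∎

module LocalFactor where
  open import Data.Nat as ℕ using (_^_)
  open import Data.Rational using (ℚ; 1ℚ; _*_; _-_)
  open import Data.Rational.Properties using (*-zeroʳ)
  open import Relation.Binary.PropositionalEquality

  -- factor n p unfolds to localFactor p (ν p n).
  localFactor : ℕ → ℕ → ℚ
  localFactor p j = inv (1ℚ - (ℕtoℚ p * inv (ℕtoℚ (p ^ 2) - 1ℚ)) * (1ℚ - inv (ℕtoℚ (p ^ (2 ℕ.* j)))))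

  localFactor-0 : ∀ p → localFactor p 0 ≡ 1ℚ
  localFactor-0 p = cong (λ x → inv (1ℚ - x)) (*-zeroʳ (ℕtoℚ p * inv (ℕtoℚ (p ^ 2) - 1ℚ)))

module PrimePower (k : ℕ) where
  open import Data.Nat as ℕ using (zero; suc; _^_; _<_; z≤n; s≤s)
  import Data.Nat.Properties as ℕ
  open import Data.Nat.GCD using (gcd)
  open import Data.Nat.Primality using (Prime)
  open import Data.Rational using (ℚ; 0ℚ; 1ℚ; _+_; _*_; _-_)
  open import Data.Rational.Properties using (+-identityʳ; *-identityʳ)
  open Arithmetic using (gcd[pq+r,p^j]≡1; gcd[pq,p^1+j]≡p*gcd[q,p^j]; gcd[pq+p,p^1+j]≢1)
  open import Function using (_∘_)
  open import Relation.Binary.PropositionalEquality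
  open Rationals
  open ResidueSums
  open PrimePowerIdentities
  open LocalFactor
  open Valuation using (ν[p^j]≡j)
  open ≡-Reasoning

  -- With p = 2 + k, a block of p residues splits definitionally into 0, then 1, …, k, then k + 1 = p - 1.
  p : ℕ
  p = 2 ℕ.+ k

  Σ-blocks : ∀ n (F A : ℕ → ℚ) d → (∀ q → F (p ℕ.* q) ≡ A q) → (∀ q r → r < k → F (p ℕ.* q ℕ.+ suc r) ≡ 1ℚ)
           → (∀ q → F (p ℕ.* q ℕ.+ suc k) ≡ d) → Σ.fold (n ℕ.* p) F ≡ Σ.fold n A + ℕtoℚ n * (ℕtoℚ k + d)
  Σ-blocks n F A d first middle last = begin
    Σ.fold (n ℕ.* p) F                                   ≡⟨ Σ.fold-* n p F ⟩
    Σ.fold n (λ q → Σ.fold p (λ r → F (p ℕ.* q ℕ.+ r)))   ≡⟨ Σ.fold-cong n (λ q _ → block q) ⟩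
    Σ.fold n (λ q → A q + (ℕtoℚ k + d))                  ≡⟨ Σ.fold-∙ n A _ ⟩
    Σ.fold n A + Σ.fold n (λ _ → ℕtoℚ k + d)             ≡⟨ cong (Σ.fold n A +_) (Σ-const n _) ⟩
    Σ.fold n A + ℕtoℚ n * (ℕtoℚ k + d)                   ∎
    where
    block : ∀ q → Σ.fold p (λ r → F (p ℕ.* q ℕ.+ r)) ≡ A q + (ℕtoℚ k + d)
    block q = cong₂ _+_ (trans (cong F (ℕ.+-identityʳ (p ℕ.* q))) (first q)) (begin
      Σ.fold (suc k) (λ r → F (p ℕ.* q ℕ.+ suc r))
        ≡⟨ Σ.fold-suc k _ ⟩
      Σ.fold k (λ r → F (p ℕ.* q ℕ.+ suc r)) + F (p ℕ.* q ℕ.+ suc k)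
        ≡⟨ cong₂ _+_ (Σ.fold-cong k (middle q)) (last q) ⟩
      Σ.fold k (λ _ → 1ℚ) + d
        ≡⟨ cong (_+ d) (trans (Σ-const k 1ℚ) (*-identityʳ (ℕtoℚ k))) ⟩
      ℕtoℚ k + d ∎)

  module _ (p-prime : Prime p) where
    P : ℚ
    P = ℕtoℚ p

    N : ℕ → ℚ
    N e = ℕtoℚ (p ^ e)

    T : ℕ → ℚ
    T e = reciprocalGcdSum (p ^ e)

    p^[1+e]≡p^e*p : ∀ e → p ^ suc e ≡ p ^ e ℕ.* p
    p^[1+e]≡p^e*p e = ℕ.*-comm p (p ^ e)

    P*inv[P]≡1 : P * inv P ≡ 1ℚ
    P*inv[P]≡1 = *-inv P (ℕtoℚ-≢0 {p} λ ())

    N[1+e]≡P*N[e] : ∀ e → N (suc e) ≡ P * N e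
    N[1+e]≡P*N[e] e = ℕtoℚ-* p (p ^ e)

    inv[N[1+e]]≡inv[P]*inv[N[e]] : ∀ e → inv (N (suc e)) ≡ inv P * inv (N e)
    inv[N[1+e]]≡inv[P]*inv[N[e]] e = trans (cong inv (N[1+e]≡P*N[e] e)) (inv-* P (N e))

    k+1≡P-1 : ℕtoℚ k + 1ℚ ≡ P - 1ℚ
    k+1≡P-1 = trans (sym (ℕtoℚ-+ k 1)) (trans (cong ℕtoℚ (ℕ.+-comm k 1)) (ℕtoℚ-∸ {p} {1} (s≤s z≤n)))

    k+0≡P-2 : ℕtoℚ k + 0ℚ ≡ P - 1ℚ - 1ℚ
    k+0≡P-2 = trans (+-identityʳ (ℕtoℚ k))
                    (trans (ℕtoℚ-∸ {suc k} {1} (s≤s z≤n)) (cong (_- 1ℚ) (ℕtoℚ-∸ {p} {1} (s≤s z≤n))))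

    inv-gcd[pq,p^1+e] : ∀ e q → inv (ℕtoℚ (gcd (p ℕ.* q) (p ^ suc e))) ≡ inv P * inv (ℕtoℚ (gcd q (p ^ e)))
    inv-gcd[pq,p^1+e] e q = trans (cong (inv ∘ ℕtoℚ) (gcd[pq,p^1+j]≡p*gcd[q,p^j] p q e))
                                  (trans (cong inv (ℕtoℚ-* p (gcd q (p ^ e)))) (inv-* P (ℕtoℚ (gcd q (p ^ e)))))

    gcd[pq+1+r,p^j]≡1 : ∀ q r j → r < suc k → gcd (p ℕ.* q ℕ.+ suc r) (p ^ j) ≡ 1
    gcd[pq+1+r,p^j]≡1 q r j r<1+k = gcd[pq+r,p^j]≡1 p-prime q (s≤s z≤n) (s≤s r<1+k) j

    coprime-first : ∀ q j → gcd (suc (p ℕ.* q)) (p ^ j) ≡ 1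
    coprime-first q j = trans (cong (λ a → gcd a (p ^ j)) (ℕ.+-comm 1 (p ℕ.* q))) (gcd[pq+1+r,p^j]≡1 q 0 j (s≤s z≤n))

    coprime-middle : ∀ q r j → r < k → gcd (suc (p ℕ.* q ℕ.+ suc r)) (p ^ j) ≡ 1
    coprime-middle q r j r<k = trans (cong (λ a → gcd a (p ^ j)) (sym (ℕ.+-suc (p ℕ.* q) (suc r))))
                                     (gcd[pq+1+r,p^j]≡1 q (suc r) j (s≤s r<k))

    not-coprime-last : ∀ q e → gcd (suc (p ℕ.* q ℕ.+ suc k)) (p ^ suc e) ≢ 1
    not-coprime-last q e =
      subst (λ a → gcd a (p ^ suc e) ≢ 1) (ℕ.+-suc (p ℕ.* q) (suc k)) (gcd[pq+p,p^1+j]≢1 p-prime q e)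

    T-step : ∀ e → T (suc e) ≡ inv P * T e + N e * (P - 1ℚ)
    T-step e = begin
      T (suc e)
        ≡⟨ cong (λ n → Σ.fold n F) (p^[1+e]≡p^e*p e) ⟩
      Σ.fold (p ^ e ℕ.* p) F
        ≡⟨ Σ-blocks (p ^ e) F _ 1ℚ (inv-gcd[pq,p^1+e] e) middle (λ q → unit q k ℕ.≤-refl) ⟩
      Σ.fold (p ^ e) (λ q → inv P * inv (ℕtoℚ (gcd q (p ^ e)))) + N e * (ℕtoℚ k + 1ℚ)
        ≡⟨ cong₂ _+_ (Σ-*ˡ (p ^ e) (inv P) _) (cong (N e *_) (sym k+1≡P-1)) ⟨
      inv P * T e + N e * (P - 1ℚ) ∎
      where
      F = λ b → inv (ℕtoℚ (gcd b (p ^ suc e)))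
      unit : ∀ q r → r < suc k → F (p ℕ.* q ℕ.+ suc r) ≡ 1ℚ
      unit q r r<1+k = cong (inv ∘ ℕtoℚ) (gcd[pq+1+r,p^j]≡1 q r (suc e) r<1+k)
      middle : ∀ q r → r < k → F (p ℕ.* q ℕ.+ suc r) ≡ 1ℚ
      middle q r r<k = unit q r (ℕ.m≤n⇒m≤1+n r<k)

    Ssum-step : ∀ e → Ssum (p ^ suc e) ≡ inv P * T e + N e * (P - 1ℚ - 1ℚ)
    Ssum-step e = begin
      Ssum (p ^ suc e)
        ≡⟨ Ssum≡Σ (p ^ suc e) ⟩
      Σ.fold (p ^ suc e) F
        ≡⟨ cong (λ n → Σ.fold n F) (p^[1+e]≡p^e*p e) ⟩
      Σ.fold (p ^ e ℕ.* p) F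
        ≡⟨ Σ-blocks (p ^ e) F _ 0ℚ first middle last ⟩
      Σ.fold (p ^ e) (λ q → inv P * inv (ℕtoℚ (gcd q (p ^ e)))) + N e * (ℕtoℚ k + 0ℚ)
        ≡⟨ cong₂ _+_ (Σ-*ˡ (p ^ e) (inv P) _) (cong (N e *_) (sym k+0≡P-2)) ⟨
      inv P * T e + N e * (P - 1ℚ - 1ℚ) ∎
      where
      F = S-summand (p ^ suc e)
      first : ∀ q → F (p ℕ.* q) ≡ inv P * inv (ℕtoℚ (gcd q (p ^ e)))
      first q = trans (ifCoprime-yes {p ^ suc e} {suc (p ℕ.* q)} _ (coprime-first q (suc e)))
                      (inv-gcd[pq,p^1+e] e q)
      middle : ∀ q r → r < k → F (p ℕ.* q ℕ.+ suc r) ≡ 1ℚ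
      middle q r r<k = trans (ifCoprime-yes {p ^ suc e} {suc (p ℕ.* q ℕ.+ suc r)} _
                                            (coprime-middle q r (suc e) r<k))
                             (cong (inv ∘ ℕtoℚ) (gcd[pq+1+r,p^j]≡1 q r (suc e) (ℕ.m≤n⇒m≤1+n r<k)))
      last : ∀ q → F (p ℕ.* q ℕ.+ suc k) ≡ 0ℚ
      last q = ifCoprime-no {p ^ suc e} {suc (p ℕ.* q ℕ.+ suc k)} _ (not-coprime-last q e)

    φ-step : ∀ e → ℕtoℚ (φ (p ^ suc e)) ≡ N e * (P - 1ℚ)
    φ-step e = begin
      ℕtoℚ (φ (p ^ suc e))
        ≡⟨ φ≡Σ (p ^ suc e) ⟩
      Σ.fold (p ^ suc e) F
        ≡⟨ cong (λ n → Σ.fold n F) (p^[1+e]≡p^e*p e) ⟩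
      Σ.fold (p ^ e ℕ.* p) F
        ≡⟨ Σ-blocks (p ^ e) F (λ _ → 1ℚ) 0ℚ first middle last ⟩
      Σ.fold (p ^ e) (λ _ → 1ℚ) + N e * (ℕtoℚ k + 0ℚ)
        ≡⟨ cong₂ _+_ (Σ-const (p ^ e) 1ℚ) (cong (N e *_) k+0≡P-2) ⟩
      N e * 1ℚ + N e * (P - 1ℚ - 1ℚ)
        ≡⟨ N+N[P-2]≡N[P-1] (N e) P ⟩
      N e * (P - 1ℚ) ∎
      where
      F = φ-summand (p ^ suc e)
      first : ∀ q → F (p ℕ.* q) ≡ 1ℚ
      first q = ifCoprime-yes {p ^ suc e} {suc (p ℕ.* q)} _ (coprime-first q (suc e))
      middle : ∀ q r → r < k → F (p ℕ.* q ℕ.+ suc r) ≡ 1ℚ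
      middle q r r<k = ifCoprime-yes {p ^ suc e} {suc (p ℕ.* q ℕ.+ suc r)} _ (coprime-middle q r (suc e) r<k)
      last : ∀ q → F (p ℕ.* q ℕ.+ suc k) ≡ 0ℚ
      last q = ifCoprime-no {p ^ suc e} {suc (p ℕ.* q ℕ.+ suc k)} _ (not-coprime-last q e)

    closed-form : ∀ e → (P + 1ℚ) * T e ≡ P * N e + inv (N e)
    closed-form zero = trans (*-identityʳ (P + 1ℚ)) (cong (_+ 1ℚ) (sym (*-identityʳ P)))
    closed-form (suc e) = begin
      (P + 1ℚ) * T (suc e)
        ≡⟨ cong ((P + 1ℚ) *_) (T-step e) ⟩
      (P + 1ℚ) * (inv P * T e + N e * (P - 1ℚ))
        ≡⟨ closed-form-step P (inv P) (N e) (inv (N e)) (T e) P*inv[P]≡1 (closed-form e) ⟩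
      P * (P * N e) + inv P * inv (N e)
        ≡⟨ cong₂ _+_ (cong (P *_) (N[1+e]≡P*N[e] e)) (inv[N[1+e]]≡inv[P]*inv[N[e]] e) ⟨
      P * N (suc e) + inv (N (suc e)) ∎

    P*P-1≢0 : P * P - 1ℚ ≢ 0ℚ
    P*P-1≢0 = subst (_≢ 0ℚ) (trans (ℕtoℚ-∸ {p ℕ.* p} {1} (s≤s z≤n)) (cong (_- 1ℚ) (ℕtoℚ-* p p)))
                    (ℕtoℚ-≢0 {p ℕ.* p ℕ.∸ 1} λ ())

    N≢0 : ∀ e → N e ≢ 0ℚ
    N≢0 e = ℕtoℚ-≢0 (ℕ.≢-nonZero⁻¹ (p ^ e) {{ℕ.m^n≢0 p e}})

    inv[N[2j]]≡inv[N[j]]² : ∀ j → inv (ℕtoℚ (p ^ (2 ℕ.* j))) ≡ inv (N j) * inv (N j)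
    inv[N[2j]]≡inv[N[j]]² j = begin
      inv (ℕtoℚ (p ^ (j ℕ.+ (j ℕ.+ 0))))    ≡⟨ cong (λ x → inv (ℕtoℚ (p ^ (j ℕ.+ x)))) (ℕ.+-identityʳ j) ⟩
      inv (ℕtoℚ (p ^ (j ℕ.+ j)))           ≡⟨ cong (inv ∘ ℕtoℚ) (ℕ.^-distribˡ-+-* p j j) ⟩
      inv (ℕtoℚ (p ^ j ℕ.* p ^ j))         ≡⟨ cong inv (ℕtoℚ-* (p ^ j) (p ^ j)) ⟩
      inv (N j * N j)                      ≡⟨ inv-* (N j) (N j) ⟩
      inv (N j) * inv (N j)                ∎

    localFactor-expanded : ∀ e → localFactor p (suc e)
                 ≡ inv (1ℚ - P * inv (P * P - 1ℚ) * (1ℚ - inv P * inv (N e) * (inv P * inv (N e))))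
    localFactor-expanded e = cong₂ (λ x y → inv (1ℚ - P * inv (x - 1ℚ) * (1ℚ - y))) P²
                           (trans (inv[N[2j]]≡inv[N[j]]² (suc e)) (cong (λ x → x * x) (inv[N[1+e]]≡inv[P]*inv[N[e]] e)))
      where
      P² : ℕtoℚ (p ^ 2) ≡ P * P
      P² = trans (cong ℕtoℚ (cong (p ℕ.*_) (ℕ.*-identityʳ p))) (ℕtoℚ-* p p)

    H-prime-power : ∀ e → H (p ^ suc e) ≡ factor (p ^ suc e) p
    H-prime-power e = begin
      Φ * inv (Ssum (p ^ suc e))     ≡⟨ cong (λ x → Φ * inv x) Ssum≡Φ*D ⟩
      Φ * inv (Φ * D)                ≡⟨ *-inv-* Φ D (ℕtoℚ-≢0 (φ≢0 (ℕ.m^n>0 p (suc e)))) ⟩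
      inv D                          ≡⟨ localFactor-expanded e ⟨
      localFactor p (suc e)          ≡⟨ cong (localFactor p) (ν[p^j]≡j p-prime (suc e)) ⟨
      factor (p ^ suc e) p           ∎
      where
      Φ = ℕtoℚ (φ (p ^ suc e))
      D = 1ℚ - P * inv (P * P - 1ℚ) * (1ℚ - inv P * inv (N e) * (inv P * inv (N e)))
      Ssum≡Φ*D : Ssum (p ^ suc e) ≡ Φ * D
      Ssum≡Φ*D = begin
        Ssum (p ^ suc e)
          ≡⟨ Ssum-step e ⟩
        inv P * T e + N e * (P - 1ℚ - 1ℚ)
          ≡⟨ prime-power-identity P (inv P) (N e) (inv (N e)) (T e) (inv (P * P - 1ℚ))
               P*inv[P]≡1 (*-inv (N e) (N≢0 e)) (*-inv (P * P - 1ℚ) P*P-1≢0) (closed-form e) ⟩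
        N e * (P - 1ℚ) * D
          ≡⟨ cong (_* D) (φ-step e) ⟨
        Φ * D ∎

module EulerProduct where
  open import Data.Nat as ℕ using (suc; _^_; _<_; _≤_; s≤s)
  import Data.Nat.Properties as ℕ
  open import Data.Nat.Divisibility using (_∣_; _∣?_; ∣⇒≤)
  open import Data.Product using (_,_)
  open import Function using (_∘_)
  open import Data.Nat.Coprimality using (Coprime)
  open import Data.Nat.Primality using (Prime; prime?)
  open import Data.Rational using (ℚ; 1ℚ; _*_)
  open import Data.Rational.Properties using (*-1-commutativeMonoid; *-identityˡ; *-identityʳ)
  open import Relation.Nullary using (yes; no; ¬_; contradiction)
  open import Relation.Binary.PropositionalEquality
  open Arithmetic using (prime⇒≢1; prime∤prime^; prime≤prime^[1+e])
  open Valuation using (ν≡0; ν-*)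
  open LocalFactor
  open ≡-Reasoning

  module Π = RangeFold *-1-commutativeMonoid

  eulerFactor : ℕ → ℕ → ℚ
  eulerFactor n q = Π.select (prime? q) (factor n q)

  eulerProductUpTo : ℕ → ℕ → ℚ
  eulerProductUpTo n N = Π.fold N (λ i → eulerFactor n (suc i))

  eulerProduct≡eulerProductUpTo : ∀ n → eulerProduct n ≡ eulerProductUpTo n n
  eulerProduct≡eulerProductUpTo n = trans (Π.foldr-filter prime? (factor n) (range1 n)) (Π.foldr-map-range1 n _)

  eulerFactor-∤ : ∀ {n q} → 1 ≤ n → (Prime q → ¬ q ∣ n) → eulerFactor n q ≡ 1ℚ
  eulerFactor-∤ {n} {q} 1≤n q∤n with prime? q
  ... | yes q-prime = trans (cong (localFactor q) (ν≡0 q-prime (q∤n q-prime) 1≤n)) (localFactor-0 q)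
  ... | no _ = refl

  eulerFactor-* : ∀ {m k} q → 1 ≤ m → 1 ≤ k → Coprime m k → eulerFactor (m ℕ.* k) q ≡ eulerFactor m q * eulerFactor k q
  eulerFactor-* {m} {k} q 1≤m 1≤k m⊥k with prime? q
  ... | no _ = refl
  ... | yes q-prime with q ∣? m
  ...   | no q∤m = begin
    localFactor q (ν q (m ℕ.* k))
      ≡⟨ cong (localFactor q) (trans (ν-* q-prime 1≤m 1≤k) (cong (ℕ._+ ν q k) νₘ≡0)) ⟩
    localFactor q (ν q k)
      ≡⟨ *-identityˡ _ ⟨
    1ℚ * localFactor q (ν q k)
      ≡⟨ cong (_* localFactor q (ν q k)) (trans (cong (localFactor q) νₘ≡0) (localFactor-0 q)) ⟨
    factor m q * factor k q ∎
    where νₘ≡0 = ν≡0 q-prime q∤m 1≤m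
  ...   | yes q∣m = begin
    localFactor q (ν q (m ℕ.* k))
      ≡⟨ cong (localFactor q) (trans (ν-* q-prime 1≤m 1≤k) (trans (cong (ν q m ℕ.+_) νₖ≡0) (ℕ.+-identityʳ _))) ⟩
    localFactor q (ν q m)
      ≡⟨ *-identityʳ _ ⟨
    localFactor q (ν q m) * 1ℚ
      ≡⟨ cong (localFactor q (ν q m) *_) (trans (cong (localFactor q) νₖ≡0) (localFactor-0 q)) ⟨
    factor m q * factor k q ∎
    where
    q∤k : ¬ q ∣ k
    q∤k q∣k = prime⇒≢1 q-prime (m⊥k (q∣m , q∣k))
    νₖ≡0 = ν≡0 q-prime q∤k 1≤k

  eulerProductUpTo-stable : ∀ {n N} → 1 ≤ n → n ≤ N → eulerProductUpTo n N ≡ eulerProduct n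
  eulerProductUpTo-stable {n} {N} 1≤n n≤N = begin
    eulerProductUpTo n N
      ≡⟨ cong (eulerProductUpTo n) (ℕ.m+[n∸m]≡n n≤N) ⟨
    Π.fold (n ℕ.+ (N ℕ.∸ n)) F
      ≡⟨ Π.fold-+ n (N ℕ.∸ n) F ⟩
    Π.fold n F * Π.fold (N ℕ.∸ n) (λ i → F (n ℕ.+ i))
      ≡⟨ cong (Π.fold n F *_) (Π.fold-ε (N ℕ.∸ n) (λ i _ → beyond i)) ⟩
    Π.fold n F * 1ℚ
      ≡⟨ *-identityʳ _ ⟩
    eulerProductUpTo n n
      ≡⟨ eulerProduct≡eulerProductUpTo n ⟨
    eulerProduct n ∎
    where
    F = λ i → eulerFactor n (suc i)
    beyond : ∀ i → F (n ℕ.+ i) ≡ 1ℚ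
    beyond i = eulerFactor-∤ 1≤n (λ _ q∣n → ℕ.<⇒≱ (s≤s (ℕ.m≤m+n n i)) (∣⇒≤ {{ℕ.>-nonZero 1≤n}} q∣n))

  eulerProduct-multiplicative : ∀ {m k} → 1 ≤ m → 1 ≤ k → Coprime m k
                              → eulerProduct (m ℕ.* k) ≡ eulerProduct m * eulerProduct k
  eulerProduct-multiplicative {m} {k} 1≤m 1≤k m⊥k = begin
    eulerProduct (m ℕ.* k)
      ≡⟨ eulerProduct≡eulerProductUpTo (m ℕ.* k) ⟩
    Π.fold (m ℕ.* k) (λ i → eulerFactor (m ℕ.* k) (suc i))
      ≡⟨ Π.fold-cong (m ℕ.* k) (λ i _ → eulerFactor-* (suc i) 1≤m 1≤k m⊥k) ⟩
    Π.fold (m ℕ.* k) (λ i → eulerFactor m (suc i) * eulerFactor k (suc i))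
      ≡⟨ Π.fold-∙ (m ℕ.* k) _ _ ⟩
    eulerProductUpTo m (m ℕ.* k) * eulerProductUpTo k (m ℕ.* k)
      ≡⟨ cong₂ _*_ (eulerProductUpTo-stable 1≤m (ℕ.m≤m*n m k {{ℕ.>-nonZero 1≤k}}))
                   (eulerProductUpTo-stable 1≤k (ℕ.m≤n*m k m {{ℕ.>-nonZero 1≤m}})) ⟩
    eulerProduct m * eulerProduct k                               ∎

  eulerProduct-prime-power : ∀ {p} → Prime p → ∀ e → eulerProduct (p ^ suc e) ≡ factor (p ^ suc e) p
  eulerProduct-prime-power {p@(suc p-1)} p-prime e = begin
    eulerProduct (p ^ suc e)
      ≡⟨ eulerProduct≡eulerProductUpTo (p ^ suc e) ⟩
    eulerProductUpTo (p ^ suc e) (p ^ suc e)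
      ≡⟨ Π.fold-single (p ^ suc e) p-1 _ (prime≤prime^[1+e] p-prime e) other-primes ⟩
    eulerFactor (p ^ suc e) p
      ≡⟨ at-p ⟩
    factor (p ^ suc e) p ∎
    where
    1≤p^[1+e] = ℕ.m^n>0 p (suc e)
    other-primes : ∀ i → i < p ^ suc e → i ≢ p-1 → eulerFactor (p ^ suc e) (suc i) ≡ 1ℚ
    other-primes i _ i≢p-1 =
      eulerFactor-∤ 1≤p^[1+e] (λ q-prime → prime∤prime^ p-prime q-prime (i≢p-1 ∘ ℕ.suc-injective) (suc e))
    at-p : eulerFactor (p ^ suc e) p ≡ factor (p ^ suc e) p
    at-p with prime? p
    ... | yes _ = refl
    ... | no ¬p-prime = contradiction p-prime ¬p-prime

module MultiplicativeFunctions {a} {A : Set a} (_∙_ : A → A → A) where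
  open import Data.Nat
  open import Data.Nat.Properties
  open import Data.Nat.Divisibility using (_∣_)
  open import Data.Nat.Coprimality as Coprimality using (Coprime)
  open import Data.Nat.Induction using (<-rec)
  open import Data.Nat.Primality using (Prime)
  open import Data.Product using (_,_)
  open import Relation.Nullary using (contradiction)
  open import Relation.Binary.PropositionalEquality
  open Arithmetic using (prime-divisor; prime⇒>1; prime≤prime^[1+e]; prime∤⇒coprime; coprime-^)
  open Valuation using (prime-power-split)

  Multiplicative : (ℕ → A) → Set a
  Multiplicative f = ∀ {m k} → 1 ≤ m → 1 ≤ k → Coprime m k → f (m * k) ≡ f m ∙ f k

  multiplicative-unique : ∀ {f g} → Multiplicative f → Multiplicative g → f 1 ≡ g 1
                        → (∀ {p} → Prime p → ∀ e → f (p ^ suc e) ≡ g (p ^ suc e))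
                        → ∀ n → 1 ≤ n → f n ≡ g n
  multiplicative-unique {f} {g} f-mult g-mult f1≡g1 agree-on-prime-powers = <-rec (λ n → 1 ≤ n → f n ≡ g n) agree
    where
    agree : ∀ n → (∀ {m} → m < n → 1 ≤ m → f m ≡ g m) → 1 ≤ n → f n ≡ g n
    agree (suc zero) _ _ = f1≡g1
    agree n@(suc (suc _)) rec _ with prime-divisor n (s≤s (s≤s z≤n))
    ... | p , p-prime , p∣n with prime-power-split p-prime n (s≤s z≤n)
    ...   | zero , m , n≡1*m , p∤m , _ = contradiction (subst (p ∣_) (trans n≡1*m (*-identityˡ m)) p∣n) p∤m
    ...   | suc e , m , n≡p^[1+e]*m , p∤m , 1≤m = begin
      f n                              ≡⟨ cong f n≡p^[1+e]*m ⟩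
      f (p ^ suc e * m)                ≡⟨ f-mult 1≤p^[1+e] 1≤m p^[1+e]⊥m ⟩
      f (p ^ suc e) ∙ f m              ≡⟨ cong₂ _∙_ (agree-on-prime-powers p-prime e) (rec m<n 1≤m) ⟩
      g (p ^ suc e) ∙ g m              ≡⟨ g-mult 1≤p^[1+e] 1≤m p^[1+e]⊥m ⟨
      g (p ^ suc e * m)                ≡⟨ cong g n≡p^[1+e]*m ⟨
      g n                              ∎
      where
      open ≡-Reasoning
      instance _ = >-nonZero 1≤m
      1<p^[1+e] : 1 < p ^ suc e
      1<p^[1+e] = <-≤-trans (prime⇒>1 p-prime) (prime≤prime^[1+e] p-prime e)
      1≤p^[1+e] : 1 ≤ p ^ suc e
      1≤p^[1+e] = <⇒≤ 1<p^[1+e]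
      p^[1+e]⊥m : Coprime (p ^ suc e) m
      p^[1+e]⊥m = Coprimality.sym (coprime-^ (prime∤⇒coprime p-prime p∤m) (suc e))
      m<n : m < n
      m<n = subst (m <_) (trans (*-comm m (p ^ suc e)) (sym n≡p^[1+e]*m)) (m<m*n m (p ^ suc e) 1<p^[1+e])

open ResidueSums using (H-multiplicative)
open EulerProduct using (eulerProduct-multiplicative; eulerProduct-prime-power)
open MultiplicativeFunctions Data.Rational._*_ using (multiplicative-unique)

H≡eulerProduct-on-prime-powers : ∀ {p} → Prime p → ∀ e → H (p ^ suc e) ≡ eulerProduct (p ^ suc e)
H≡eulerProduct-on-prime-powers {suc (suc k)} p-prime e =
  ≡.trans (PrimePower.H-prime-power k p-prime e) (≡.sym (eulerProduct-prime-power p-prime e))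

mainTheorem8 : (n : ℕ) → n ≥ 1 → H n ≡ eulerProduct n
mainTheorem8 = multiplicative-unique (λ _ 1≤k m⊥k → H-multiplicative 1≤k m⊥k) eulerProduct-multiplicative
                                     ≡.refl H≡eulerProduct-on-prime-powers
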